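{- Let $k>1$ be an integer and define $(a_n)_{n\ge0}$, $(b_n)_{n\ge0}$ by $a_0=b_0=1$ and, for $n\ge1$, $a_n=a_{n-1}^2+k b_{n-1}^2$, $b_n=2a_{n-1}b_{n-1}$. Then for every $n\ge1$, $k b_n^2+(k-1)^{2^n}$ is a perfect square, namely equal to $a_n^2$, and for every $n\ge2$, $$b_n=2b_{n-1}\sqrt{k b_{n-1}^2+(k-1)^{2^{n-1}}}.$$ -}

module Defs where

open import Data.Nat using (ℕ; zero; suc; _+_; _*_)
open import Data.Product using (_×_; _,_; proj₁; proj₂)

ab : ℕ → ℕ → ℕ × ℕ
ab k zero = 1 , 1
ab k (suc n) with ab k n
... | (a , b) = a * a + k * (b * b) , 2 * a * b

a : ℕ → ℕ → ℕ
a k n = proj₁ (ab k n)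

b : ℕ → ℕ → ℕ
b k n = proj₂ (ab k n)

{-# OPTIONS --safe #-}
module Submission where

open import Defs
open import Data.List using ([]; _∷_)
open import Data.Nat using (ℕ; zero; suc; _+_; _*_; _∸_; _^_; _<_; _≤_; s≤s; z≤n)
open import Data.Nat.Properties using (*-comm; *-identityʳ; ^-*-assoc)
open import Data.Nat.Tactic.RingSolver using (solve)
open import Data.Product using (_×_; ∃-syntax; _,_)
open import Relation.Binary.PropositionalEquality using (_≡_; sym; trans; cong; module ≡-Reasoning)
open ≡-Reasoning

-- With k = m + 1 we have aₙ + bₙ√k = (1 + √k)^(2ⁿ), and k bₙ² + m^(2ⁿ) = aₙ² says that the
-- norm aₙ² − k bₙ² equals m^(2ⁿ).  Squaring x + y√k squares its norm, and the norm of
-- a₁ + b₁√k = (k + 1) + 2√k is (k − 1)² = m², which gives the first claim by induction.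
-- The square root in the second claim is then aₙ₋₁, so bₙ = 2 aₙ₋₁ bₙ₋₁ is the stated formula.

m*m≡m^2 : ∀ m → m * m ≡ m ^ 2
m*m≡m^2 m = cong (m *_) (sym (*-identityʳ m))

^-2^-suc : ∀ m n → m ^ (2 ^ suc n) ≡ m ^ (2 ^ n) * m ^ (2 ^ n)
^-2^-suc m n = begin
  m ^ (2 * 2 ^ n)            ≡⟨ cong (m ^_) (*-comm 2 (2 ^ n)) ⟩
  m ^ (2 ^ n * 2)            ≡⟨ sym (^-*-assoc m (2 ^ n) 2) ⟩
  (m ^ (2 ^ n)) ^ 2          ≡⟨ sym (m*m≡m^2 (m ^ (2 ^ n))) ⟩
  m ^ (2 ^ n) * m ^ (2 ^ n)  ∎

-- Squares are written x * x from here on: the reflective ring solver does not understand _^_.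
norm-square : ∀ k d x y → k * (y * y) + d ≡ x * x →
              k * ((2 * x * y) * (2 * x * y)) + d * d ≡ (x * x + k * (y * y)) * (x * x + k * (y * y))
norm-square k d x y norm = begin
  k * ((2 * x * y) * (2 * x * y)) + d * d        ≡⟨ solve (k ∷ d ∷ x ∷ y ∷ []) ⟩
  4 * (k * (y * y)) * (x * x) + d * d            ≡⟨ cong (λ t → 4 * (k * (y * y)) * t + d * d) (sym norm) ⟩
  4 * (k * (y * y)) * (k * (y * y) + d) + d * d  ≡⟨ solve (k ∷ d ∷ y ∷ []) ⟩
  (k * (y * y) + d + k * (y * y)) * (k * (y * y) + d + k * (y * y))
    ≡⟨ cong (λ t → (t + k * (y * y)) * (t + k * (y * y))) norm ⟩
  (x * x + k * (y * y)) * (x * x + k * (y * y))  ∎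

norm-ab : ∀ m n → suc m * (b (suc m) (suc n) * b (suc m) (suc n)) + m ^ (2 ^ suc n)
                  ≡ a (suc m) (suc n) * a (suc m) (suc n)
norm-ab m zero    = norm-ab₁ m
  where
  -- the goal for n = 0 in normal form, with a₁ = 1 + k and b₁ = 2
  norm-ab₁ : ∀ m → suc m * (2 * 2) + m * (m * 1) ≡ (1 + suc m * 1) * (1 + suc m * 1)
  norm-ab₁ m = solve (m ∷ [])
norm-ab m (suc n) = begin
  k * (b k (2 + n) * b k (2 + n)) + m ^ (2 ^ (2 + n))  ≡⟨ cong (k * (b k (2 + n) * b k (2 + n)) +_) (^-2^-suc m (suc n)) ⟩
  k * (b k (2 + n) * b k (2 + n)) + d * d              ≡⟨ norm-square k d (a k (suc n)) (b k (suc n)) (norm-ab m n) ⟩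
  a k (2 + n) * a k (2 + n)                            ∎
  where
  k d : ℕ
  k = suc m
  d = m ^ (2 ^ suc n)

b-suc : ∀ k n → b k (suc n) ≡ 2 * b k n * a k n
b-suc k n = swap (a k n) (b k n)
  where
  swap : ∀ x y → 2 * x * y ≡ 2 * y * x
  swap x y = solve (x ∷ y ∷ [])

mainTheorem14 : (k : ℕ) → 1 < k →
    ((n : ℕ) → 1 ≤ n →
      k * (b k n ^ 2) + (k ∸ 1) ^ (2 ^ n) ≡ a k n ^ 2)
    × ((n : ℕ) → 2 ≤ n →
      ∃[ s ] (s * s ≡ k * (b k (n ∸ 1) ^ 2) + (k ∸ 1) ^ (2 ^ (n ∸ 1))
              × b k n ≡ 2 * b k (n ∸ 1) * s))
mainTheorem14 (suc m) _ = norm-identity , square-root-recursion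
  where
  k : ℕ
  k = suc m

  norm-identity : (n : ℕ) → 1 ≤ n → k * (b k n ^ 2) + m ^ (2 ^ n) ≡ a k n ^ 2
  norm-identity (suc n) _ = begin
    k * b k (suc n) ^ 2 + m ^ (2 ^ suc n)              ≡⟨ cong (λ t → k * t + m ^ (2 ^ suc n)) (sym (m*m≡m^2 (b k (suc n)))) ⟩
    k * (b k (suc n) * b k (suc n)) + m ^ (2 ^ suc n)  ≡⟨ norm-ab m n ⟩
    a k (suc n) * a k (suc n)                          ≡⟨ m*m≡m^2 (a k (suc n)) ⟩
    a k (suc n) ^ 2                                    ∎

  square-root-recursion : (n : ℕ) → 2 ≤ n →
    ∃[ s ] (s * s ≡ k * (b k (n ∸ 1) ^ 2) + m ^ (2 ^ (n ∸ 1)) × b k n ≡ 2 * b k (n ∸ 1) * s)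
  square-root-recursion (suc zero) (s≤s ())
  square-root-recursion (suc (suc n)) _ =
    a k (suc n) , trans (m*m≡m^2 (a k (suc n))) (sym (norm-identity (suc n) (s≤s z≤n))) , b-suc k (suc n)
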